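{- Let $A,B\subseteq\mathbb{Z}$ be finite sets with $|A|=4$ and $|B|\ge 2$. Then $|A\widehat{+}B|=|A|+|B|-3$ if and only if $A=B$ and $A=\{a,c,a+d,c+d\}$ for some integers $a,c,d$.
   Context: For finite sets $A,B\subseteq\mathbb{Z}$, the restricted sumset is $A\widehat{+}B=\{a+b: a\in A,\ b\in B,\ a\neq b\}$. A pair $(A,B)$ with $|A|,|B|\ge 2$ satisfying $|A\widehat{+}B|=|A|+|B|-3$ is called a critical pair; throughout the paper all sets considered have at least two elements. -}

module Defs where

open import Data.Integer using (ℤ; _+_; _≟_)
open import Data.List using (List; deduplicate; concatMap; map; filter; length)
open import Data.List.Membership.Propositional using (_∈_)
open import Data.Product using (_×_)
open import Relation.Nullary.Decidable using (¬?)

-- A finite set of integers is represented by a duplicate-free list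
-- (the duplicate-freeness hypothesis `Unique` is imposed in the statement);
-- its cardinality is the length of the list.

_+^_ : List ℤ → List ℤ → List ℤ
A +^ B = deduplicate _≟_ (concatMap (λ a → map (a +_) (filter (λ b → ¬? (a ≟ b)) B)) A)

_≐_ : List ℤ → List ℤ → Set
A ≐ B = ∀ x → (x ∈ A → x ∈ B) × (x ∈ B → x ∈ A)

module Submission where

-- Write A = {a₁ < a₂ < a₃ < a₄}, α = min B and β = max B. For x ∈ A the translate
-- x + (B ∖ {x}) already supplies at least |B| − 1 restricted sums, so a critical pair
-- leaves room for only one sum outside it. Taking x = a₄, the sums α + y with
-- y ∈ {a₁, a₂, a₃} ∖ {α} lie below that translate; counting them forces a₄ ∈ B and
-- α ∈ A, and an element b ∈ B ∖ A would contribute the further sum α + b. With the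
-- mirror argument at a₁ (giving a₁ ∈ B and β ∈ A) this yields B ⊆ A; the five sums
-- a₁+a₂ < a₁+a₃ < a₁+a₄ < a₂+a₄ < a₃+a₄ then give |B| = 4, so B = A, and a₂ + a₃ must
-- be one of those five, i.e. a₂ + a₃ = a₁ + a₄ and A = {a₁, a₃, a₁ + d, a₃ + d} with
-- d = a₂ − a₁. Conversely, for A = B = {a, c, a + d, c + d} the two diagonals have the
-- same sum, so only five restricted sums occur.

open import Defs
import Data.Nat
import Data.Nat as ℕ
open import Data.Nat using (_≥_)
import Data.Nat.Properties as ℕ
open import Data.Integer using (ℤ; _+_; _-_; _<_; _≤_)
import Data.Integer as ℤ
import Data.Integer.Properties as ℤ
open import Data.Integer.Tactic.RingSolver using (solve-∀)
open import Algebra.Properties.AbelianGroup ℤ.+-0-abelianGroup using (∙-cancelˡ)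
open import Data.List using (List; length; _∷_; []; filter; map; _++_)
import Data.List.Properties as List
open import Data.List.Extrema ℤ.≤-totalOrder using (min; max; min≤⊤; min≤xs; ⊥≤max; xs≤max; argmin-sel; argmax-sel)
open import Data.List.Membership.Propositional using (_∈_; _∉_; find)
open import Data.List.Membership.Propositional.Properties
  using ( ∈-filter⁺; ∈-filter⁻; ∈-map⁺; ∈-map⁻; ∈-concatMap⁺; ∈-concatMap⁻
        ; ∈-deduplicate⁺; ∈-deduplicate⁻; ∈-++⁻)
open import Data.List.Membership.DecPropositional ℤ._≟_ using (_∈?_)
open import Data.List.Relation.Binary.Subset.Propositional using (_⊆_)
open import Data.List.Relation.Binary.Permutation.Propositional using (_↭_; ↭-refl; ↭-prep; ↭-swap; ↭-sym; ↭⇒↭ₛ)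
open import Data.List.Relation.Binary.Permutation.Propositional.Properties using (∈-resp-↭; ↭-length)
open import Data.List.Relation.Binary.Permutation.Setoid.Properties using (Unique-resp-↭)
open import Data.List.Relation.Unary.Any as Any using (here; there)
open import Data.List.Relation.Unary.All as All using (All; []; _∷_)
open import Data.List.Relation.Unary.AllPairs as AllPairs using (_∷_)
open import Data.List.Relation.Unary.Linked using (Linked; [-]; _∷_)
open import Data.List.Relation.Unary.Linked.Properties using (Linked⇒AllPairs)
open import Data.List.Relation.Unary.Unique.Propositional using (Unique)
import Data.List.Relation.Unary.Unique.Propositional.Properties as Unique
open import Data.List.Relation.Unary.Unique.DecPropositional.Properties using (deduplicate-!)
open import Data.List.Sort ℤ.≤-decTotalOrder using (sort; sort-↭; sort-↗)
open import Data.Empty using (⊥; ⊥-elim)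
open import Data.Product using (_×_; _,_; proj₁; proj₂; ∃-syntax)
open import Data.Sum using (inj₁; inj₂)
open import Function using (_∘_; id)
open import Function.Bundles using (_⇔_; mk⇔)
open import Relation.Nullary using (yes; no; ¬?)
open import Relation.Binary.Definitions using (DecidableEquality; tri<; tri≈; tri>)
open import Relation.Binary.PropositionalEquality
  using (_≡_; _≢_; refl; sym; trans; cong; cong₂; subst; subst₂; module ≡-Reasoning)
open import Relation.Binary.PropositionalEquality.Properties using (setoid)

pattern first  = here refl
pattern second = there (here refl)
pattern third  = there (there (here refl))
pattern fourth = there (there (there (here refl)))

module Removal {a} {X : Set a} (_≟_ : DecidableEquality X) where

  infixl 6 _∖_
  _∖_ : List X → X → List X
  xs ∖ x = filter (λ y → ¬? (x ≟ y)) xs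

  ∈-∖⁺ : ∀ {x y xs} → y ∈ xs → x ≢ y → y ∈ xs ∖ x
  ∈-∖⁺ {x} = ∈-filter⁺ (λ y → ¬? (x ≟ y))

  ∈-∖⁻ : ∀ {x y} xs → y ∈ xs ∖ x → y ∈ xs × x ≢ y
  ∈-∖⁻ {x} xs = ∈-filter⁻ (λ y → ¬? (x ≟ y)) {xs = xs}

  ∖-unique : ∀ {x xs} → Unique xs → Unique (xs ∖ x)
  ∖-unique {x} = Unique.filter⁺ (λ y → ¬? (x ≟ y))

  length-∖-∉ : ∀ {x xs} → x ∉ xs → length (xs ∖ x) ≡ length xs
  length-∖-∉ {x} {xs} x∉xs =
    cong length (List.filter-all (λ y → ¬? (x ≟ y))
                                 (All.tabulate λ y∈xs x≡y → x∉xs (subst (_∈ xs) (sym x≡y) y∈xs)))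

  length-∖-< : ∀ {x xs} → x ∈ xs → length (xs ∖ x) ℕ.< length xs
  length-∖-< {x} {xs} x∈xs = List.filter-notAll (λ y → ¬? (x ≟ y)) xs (Any.map (λ x≡y x≢y → x≢y x≡y) x∈xs)

  unique-⊆⇒length-≤ : ∀ {xs ys} → Unique xs → xs ⊆ ys → length xs ℕ.≤ length ys
  unique-⊆⇒length-≤ {[]} _ _ = ℕ.z≤n
  unique-⊆⇒length-≤ {x ∷ xs} {ys} (x∉xs ∷ xs!) xs⊆ys =
    ℕ.≤-<-trans (unique-⊆⇒length-≤ xs! (λ y∈xs → ∈-∖⁺ (xs⊆ys (there y∈xs)) (All.lookup x∉xs y∈xs)))
                (length-∖-< (xs⊆ys (here refl)))

  length-≤-suc-∖ : ∀ {x xs} → Unique xs → length xs ℕ.≤ ℕ.suc (length (xs ∖ x))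
  length-≤-suc-∖ {x} xs! = unique-⊆⇒length-≤ xs! xs⊆x∷xs∖x
    where
    xs⊆x∷xs∖x : ∀ {y zs} → y ∈ zs → y ∈ x ∷ zs ∖ x
    xs⊆x∷xs∖x {y} y∈zs with x ≟ y
    ... | yes refl = here refl
    ... | no x≢y   = there (∈-∖⁺ y∈zs x≢y)

-- With ℤ._≟_, B ∖ a is literally the list filtered in the definition of A +^ B.
open Removal ℤ._≟_

∈-+^⁺ : ∀ {A B a b} → a ∈ A → b ∈ B → a ≢ b → a + b ∈ A +^ B
∈-+^⁺ {a = a} a∈A b∈B a≢b =
  ∈-deduplicate⁺ ℤ._≟_ (∈-concatMap⁺ _ (Any.map (λ { refl → ∈-map⁺ (a +_) (∈-∖⁺ b∈B a≢b) }) a∈A))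

∈-+^⁻ : ∀ {A B s} → s ∈ A +^ B → ∃[ a ] ∃[ b ] a ∈ A × b ∈ B × a ≢ b × s ≡ a + b
∈-+^⁻ {A} {B} s∈A+^B with find (∈-concatMap⁻ _ {xs = A} (∈-deduplicate⁻ ℤ._≟_ _ s∈A+^B))
... | a , a∈A , s∈a+B∖a with ∈-map⁻ (a +_) {xs = B ∖ a} s∈a+B∖a
... | b , b∈B∖a , s≡a+b with ∈-∖⁻ B b∈B∖a
... | b∈B , a≢b = a , b , a∈A , b∈B , a≢b , s≡a+b

+^-unique : ∀ A B → Unique (A +^ B)
+^-unique A B = deduplicate-! ℤ._≟_ _

length-+^-≥ : ∀ {A B E x} → x ∈ A → Unique B → Unique E → E ⊆ A +^ B →
              (∀ {e b} → e ∈ E → b ∈ B → e ≢ x + b) →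
              length E ℕ.+ length (B ∖ x) ℕ.≤ length (A +^ B)
length-+^-≥ {A} {B} {E} {x} x∈A B! E! E⊆A+^B E∉x+B = begin
  length E ℕ.+ length (B ∖ x)              ≡⟨ cong (length E ℕ.+_) (List.length-map (x +_) (B ∖ x)) ⟨
  length E ℕ.+ length (map (x +_) (B ∖ x)) ≡⟨ List.length-++ E ⟨
  length (E ++ map (x +_) (B ∖ x))         ≤⟨ unique-⊆⇒length-≤ E++x+B! E++x+B⊆A+^B ⟩
  length (A +^ B)                          ∎
  where
  open ℕ.≤-Reasoning
  E++x+B! : Unique (E ++ map (x +_) (B ∖ x))
  E++x+B! = Unique.++⁺ E! (Unique.map⁺ (∙-cancelˡ x _ _) (∖-unique B!)) λ (e∈E , e∈x+B) →
    let b , b∈B∖x , e≡x+b = ∈-map⁻ (x +_) {xs = B ∖ x} e∈x+B in E∉x+B e∈E (proj₁ (∈-∖⁻ B b∈B∖x)) e≡x+b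
  E++x+B⊆A+^B : E ++ map (x +_) (B ∖ x) ⊆ A +^ B
  E++x+B⊆A+^B s∈ with ∈-++⁻ E s∈
  ... | inj₁ s∈E = E⊆A+^B s∈E
  ... | inj₂ s∈x+B with ∈-map⁻ (x +_) {xs = B ∖ x} s∈x+B
  ... | b , b∈B∖x , refl = let b∈B , x≢b = ∈-∖⁻ B b∈B∖x in ∈-+^⁺ x∈A b∈B x≢b

length-+^-≥-below : ∀ {A B Y x α} → x ∈ A → (∀ {b} → b ∈ B → α ≤ b) → Unique B → Unique Y →
                    (∀ {y} → y ∈ Y → y < x × α + y ∈ A +^ B) →
                    length Y ℕ.+ length (B ∖ x) ℕ.≤ length (A +^ B)
length-+^-≥-below {A} {B} {Y} {x} {α} x∈A α≤B B! Y! Y-below =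
  subst (λ n → n ℕ.+ _ ℕ.≤ _) (List.length-map (α +_) Y)
    (length-+^-≥ x∈A B! (Unique.map⁺ (∙-cancelˡ α _ _) Y!) α+Y⊆A+^B α+Y<x+B)
  where
  α+Y⊆A+^B : map (α +_) Y ⊆ A +^ B
  α+Y⊆A+^B s∈ with ∈-map⁻ (α +_) s∈
  ... | y , y∈Y , refl = proj₂ (Y-below y∈Y)
  α+Y<x+B : ∀ {e b} → e ∈ map (α +_) Y → b ∈ B → e ≢ x + b
  α+Y<x+B e∈ b∈B with ∈-map⁻ (α +_) e∈
  ... | y , y∈Y , refl = ℤ.<⇒≢ (ℤ.<-≤-trans (ℤ.+-monoʳ-< α (proj₁ (Y-below y∈Y)))
                                           (subst (_≤ x + _) (ℤ.+-comm x α) (ℤ.+-monoʳ-≤ x (α≤B b∈B))))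

length-+^-≥-above : ∀ {A B Y x β} → x ∈ A → (∀ {b} → b ∈ B → b ≤ β) → Unique B → Unique Y →
                    (∀ {y} → y ∈ Y → x < y × β + y ∈ A +^ B) →
                    length Y ℕ.+ length (B ∖ x) ℕ.≤ length (A +^ B)
length-+^-≥-above {A} {B} {Y} {x} {β} x∈A B≤β B! Y! Y-above =
  subst (λ n → n ℕ.+ _ ℕ.≤ _) (List.length-map (β +_) Y)
    (length-+^-≥ x∈A B! (Unique.map⁺ (∙-cancelˡ β _ _) Y!) β+Y⊆A+^B β+Y>x+B)
  where
  β+Y⊆A+^B : map (β +_) Y ⊆ A +^ B
  β+Y⊆A+^B s∈ with ∈-map⁻ (β +_) s∈
  ... | y , y∈Y , refl = proj₂ (Y-above y∈Y)
  β+Y>x+B : ∀ {e b} → e ∈ map (β +_) Y → b ∈ B → e ≢ x + b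
  β+Y>x+B e∈ b∈B with ∈-map⁻ (β +_) e∈
  ... | y , y∈Y , refl = ℤ.<⇒≢ (ℤ.≤-<-trans (subst (x + _ ≤_) (ℤ.+-comm x β) (ℤ.+-monoʳ-≤ x (B≤β b∈B)))
                                           (ℤ.+-monoʳ-< β (proj₁ (Y-above y∈Y)))) ∘ sym

strictly-increasing⇒unique : ∀ {xs} → Linked _<_ xs → Unique xs
strictly-increasing⇒unique = AllPairs.map ℤ.<⇒≢ ∘ Linked⇒AllPairs ℤ.<-trans

least : ∀ xs → xs ≢ [] → ∃[ α ] α ∈ xs × (∀ {x} → x ∈ xs → α ≤ x)
least []       []≢[] = ⊥-elim ([]≢[] refl)
least (x ∷ xs) _     = min x xs , min∈ , min≤
  where
  min≤ : ∀ {y} → y ∈ x ∷ xs → min x xs ≤ y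
  min≤ (here refl)  = min≤⊤ x xs
  min≤ (there y∈xs) = All.lookup (min≤xs x xs) y∈xs
  min∈ : min x xs ∈ x ∷ xs
  min∈ with argmin-sel id x xs
  ... | inj₁ min≡x  = here min≡x
  ... | inj₂ min∈xs = there min∈xs

greatest : ∀ xs → xs ≢ [] → ∃[ β ] β ∈ xs × (∀ {x} → x ∈ xs → x ≤ β)
greatest []       []≢[] = ⊥-elim ([]≢[] refl)
greatest (x ∷ xs) _     = max x xs , max∈ , ≤max
  where
  ≤max : ∀ {y} → y ∈ x ∷ xs → y ≤ max x xs
  ≤max (here refl)  = ⊥≤max x xs
  ≤max (there y∈xs) = All.lookup (xs≤max x xs) y∈xs
  max∈ : max x xs ∈ x ∷ xs
  max∈ with argmax-sel id x xs
  ... | inj₁ max≡x  = here max≡x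
  ... | inj₂ max∈xs = there max∈xs

record Sorted₄ (A : List ℤ) : Set where
  field
    a₁ a₂ a₃ a₄ : ℤ
    a₁<a₂ : a₁ < a₂
    a₂<a₃ : a₂ < a₃
    a₃<a₄ : a₃ < a₄
    enumerates : A ≐ (a₁ ∷ a₂ ∷ a₃ ∷ a₄ ∷ [])

  a₁<a₃ : a₁ < a₃
  a₁<a₃ = ℤ.<-trans a₁<a₂ a₂<a₃
  a₂<a₄ : a₂ < a₄
  a₂<a₄ = ℤ.<-trans a₂<a₃ a₃<a₄
  a₁<a₄ : a₁ < a₄
  a₁<a₄ = ℤ.<-trans a₁<a₂ a₂<a₄

  enum-⊆ : (a₁ ∷ a₂ ∷ a₃ ∷ a₄ ∷ []) ⊆ A
  enum-⊆ {t} = proj₂ (enumerates t)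

  ⊆-enum : A ⊆ (a₁ ∷ a₂ ∷ a₃ ∷ a₄ ∷ [])
  ⊆-enum {t} = proj₁ (enumerates t)

  a₁∈A : a₁ ∈ A
  a₁∈A = enum-⊆ first
  a₂∈A : a₂ ∈ A
  a₂∈A = enum-⊆ second
  a₃∈A : a₃ ∈ A
  a₃∈A = enum-⊆ third
  a₄∈A : a₄ ∈ A
  a₄∈A = enum-⊆ fourth

  ∈-lower-three : ∀ {t} → t ∈ a₁ ∷ a₂ ∷ a₃ ∷ [] → t ∈ A × t < a₄
  ∈-lower-three first  = a₁∈A , a₁<a₄
  ∈-lower-three second = a₂∈A , a₂<a₄
  ∈-lower-three third  = a₃∈A , a₃<a₄

  ∈-upper-three : ∀ {t} → t ∈ a₂ ∷ a₃ ∷ a₄ ∷ [] → t ∈ A × a₁ < t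
  ∈-upper-three first  = a₂∈A , a₁<a₂
  ∈-upper-three second = a₃∈A , a₁<a₃
  ∈-upper-three third  = a₄∈A , a₁<a₄

  a₄-greatest : ∀ {t} → t ∈ A → t ≤ a₄
  a₄-greatest t∈A with ⊆-enum t∈A
  ... | first  = ℤ.<⇒≤ a₁<a₄
  ... | second = ℤ.<⇒≤ a₂<a₄
  ... | third  = ℤ.<⇒≤ a₃<a₄
  ... | fourth = ℤ.≤-refl

sort₄ : ∀ {A} → Unique A → length A ≡ 4 → Sorted₄ A
sort₄ {A} A! |A|≡4 = sorted (sort A) (trans (↭-length (sort-↭ A)) |A|≡4) (sort-↭ A) (sort-↗ A)
  where
  sorted : ∀ S → length S ≡ 4 → S ↭ A → Linked _≤_ S → Sorted₄ A
  sorted (_ ∷ _ ∷ _ ∷ _ ∷ _ ∷ _) () _ _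
  sorted (s₁ ∷ s₂ ∷ s₃ ∷ s₄ ∷ []) _ S↭A (s₁≤s₂ ∷ s₂≤s₃ ∷ s₃≤s₄ ∷ [-])
    with Unique-resp-↭ (setoid ℤ) (↭⇒↭ₛ (↭-sym S↭A)) A!
  ... | (s₁≢s₂ ∷ _) ∷ (s₂≢s₃ ∷ _) ∷ (s₃≢s₄ ∷ _) ∷ _ = record
    { a₁<a₂      = ℤ.≤∧≢⇒< s₁≤s₂ s₁≢s₂
    ; a₂<a₃      = ℤ.≤∧≢⇒< s₂≤s₃ s₂≢s₃
    ; a₃<a₄      = ℤ.≤∧≢⇒< s₃≤s₄ s₃≢s₄
    ; enumerates = λ t → ∈-resp-↭ (↭-sym S↭A) , ∈-resp-↭ S↭A
    }

module _ {A B : List ℤ} (S : Sorted₄ A) where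
  open Sorted₄ S

  private
    ∈-+^⁺-< : ∀ {a b} → a ∈ A → b ∈ B → a < b → a + b ∈ A +^ B
    ∈-+^⁺-< a∈A b∈B a<b = ∈-+^⁺ a∈A b∈B (ℤ.<⇒≢ a<b)

    ∈-+^⁺-> : ∀ {a b} → a ∈ A → b ∈ B → b < a → a + b ∈ A +^ B
    ∈-+^⁺-> a∈A b∈B b<a = ∈-+^⁺ a∈A b∈B (ℤ.<⇒≢ b<a ∘ sym)

    increasing-sums⇒length-≤ : ∀ {xs} → Linked _<_ xs → All (_∈ A +^ B) xs → length xs ℕ.≤ length (A +^ B)
    increasing-sums⇒length-≤ increasing sums∈ =
      unique-⊆⇒length-≤ (strictly-increasing⇒unique increasing) (All.lookup sums∈)

    a₃+a₁<a₁+a₄ : a₃ + a₁ < a₁ + a₄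
    a₃+a₁<a₁+a₄ = subst (a₃ + a₁ <_) (ℤ.+-comm a₄ a₁) (ℤ.+-monoˡ-< a₁ a₃<a₄)

    a₃+a₁<a₂+a₃ : a₃ + a₁ < a₂ + a₃
    a₃+a₁<a₂+a₃ = subst (a₃ + a₁ <_) (ℤ.+-comm a₃ a₂) (ℤ.+-monoʳ-< a₃ a₁<a₂)

    six-sums : A ⊆ B → ∀ {s t} → a₃ + a₁ < s → s < t → t < a₂ + a₄ → s ∈ A +^ B → t ∈ A +^ B →
               6 ℕ.≤ length (A +^ B)
    six-sums A⊆B a₃+a₁<s s<t t<a₂+a₄ s∈ t∈ = increasing-sums⇒length-≤
      (ℤ.+-monoˡ-< a₁ a₂<a₃ ∷ a₃+a₁<s ∷ s<t ∷ t<a₂+a₄ ∷ ℤ.+-monoˡ-< a₄ a₂<a₃ ∷ [-])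
      (∈-+^⁺-> a₂∈A (A⊆B a₁∈A) a₁<a₂ ∷ ∈-+^⁺-> a₃∈A (A⊆B a₁∈A) a₁<a₃ ∷ s∈ ∷ t∈
       ∷ ∈-+^⁺-< a₂∈A (A⊆B a₄∈A) a₂<a₄ ∷ ∈-+^⁺-< a₃∈A (A⊆B a₄∈A) a₃<a₄ ∷ [])

  5≤length-+^ : a₁ ∈ B → a₄ ∈ B → 5 ℕ.≤ length (A +^ B)
  5≤length-+^ a₁∈B a₄∈B = increasing-sums⇒length-≤
    (ℤ.+-monoˡ-< a₁ a₂<a₃ ∷ a₃+a₁<a₁+a₄ ∷ ℤ.+-monoˡ-< a₄ a₁<a₂ ∷ ℤ.+-monoˡ-< a₄ a₂<a₃ ∷ [-])
    (∈-+^⁺-> a₂∈A a₁∈B a₁<a₂ ∷ ∈-+^⁺-> a₃∈A a₁∈B a₁<a₃ ∷ ∈-+^⁺-< a₁∈A a₄∈B a₁<a₄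
     ∷ ∈-+^⁺-< a₂∈A a₄∈B a₂<a₄ ∷ ∈-+^⁺-< a₃∈A a₄∈B a₃<a₄ ∷ [])

  -- Otherwise a₂ + a₃ and a₁ + a₄ are two distinct sums between a₁ + a₃ and a₂ + a₄.
  length-+^-≤5⇒a₂+a₃≡a₁+a₄ : A ⊆ B → length (A +^ B) ℕ.≤ 5 → a₂ + a₃ ≡ a₁ + a₄
  length-+^-≤5⇒a₂+a₃≡a₁+a₄ A⊆B |A+^B|≤5 with ℤ.<-cmp (a₂ + a₃) (a₁ + a₄)
  ... | tri≈ _ eq _ = eq
  ... | tri< lt _ _ = ⊥-elim (ℕ.≤⇒≯ |A+^B|≤5
        (six-sums A⊆B a₃+a₁<a₂+a₃ lt (ℤ.+-monoˡ-< a₄ a₁<a₂)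
                  (∈-+^⁺-< a₂∈A (A⊆B a₃∈A) a₂<a₃) (∈-+^⁺-< a₁∈A (A⊆B a₄∈A) a₁<a₄)))
  ... | tri> _ _ gt = ⊥-elim (ℕ.≤⇒≯ |A+^B|≤5
        (six-sums A⊆B a₃+a₁<a₁+a₄ gt (ℤ.+-monoʳ-< a₂ a₃<a₄)
                  (∈-+^⁺-< a₁∈A (A⊆B a₄∈A) a₁<a₄) (∈-+^⁺-< a₂∈A (A⊆B a₃∈A) a₂<a₃)))

IsParallelogram : List ℤ → Set
IsParallelogram A = ∃[ a ] ∃[ c ] ∃[ d ] (A ≐ (a ∷ c ∷ (a + d) ∷ (c + d) ∷ []))

module _ {A : List ℤ} (S : Sorted₄ A) where
  open Sorted₄ S

  a₂+a₃≡a₁+a₄⇒parallelogram : a₂ + a₃ ≡ a₁ + a₄ → IsParallelogram A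
  a₂+a₃≡a₁+a₄⇒parallelogram a₂+a₃≡a₁+a₄ =
    a₁ , a₃ , a₂ - a₁ ,
    subst₂ (λ u v → A ≐ (a₁ ∷ a₃ ∷ u ∷ v ∷ [])) (sym a₁+d≡a₂) (sym a₃+d≡a₄) A≐a₁a₃a₂a₄
    where
    σ : (a₁ ∷ a₂ ∷ a₃ ∷ a₄ ∷ []) ↭ (a₁ ∷ a₃ ∷ a₂ ∷ a₄ ∷ [])
    σ = ↭-prep a₁ (↭-swap a₂ a₃ ↭-refl)
    A≐a₁a₃a₂a₄ : A ≐ (a₁ ∷ a₃ ∷ a₂ ∷ a₄ ∷ [])
    A≐a₁a₃a₂a₄ t = ∈-resp-↭ σ ∘ ⊆-enum , enum-⊆ ∘ ∈-resp-↭ (↭-sym σ)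
    x+[y-x]≡y : ∀ x y → x + (y - x) ≡ y
    x+[y-x]≡y = solve-∀
    [x+y]-x≡y : ∀ x y → (x + y) - x ≡ y
    [x+y]-x≡y = solve-∀
    z+[y-x]≡[y+z]-x : ∀ x y z → z + (y - x) ≡ (y + z) - x
    z+[y-x]≡[y+z]-x = solve-∀
    a₁+d≡a₂ : a₁ + (a₂ - a₁) ≡ a₂
    a₁+d≡a₂ = x+[y-x]≡y a₁ a₂
    a₃+d≡a₄ : a₃ + (a₂ - a₁) ≡ a₄
    a₃+d≡a₄ = begin
      a₃ + (a₂ - a₁) ≡⟨ z+[y-x]≡[y+z]-x a₁ a₂ a₃ ⟩
      (a₂ + a₃) - a₁ ≡⟨ cong (_- a₁) a₂+a₃≡a₁+a₄ ⟩
      (a₁ + a₄) - a₁ ≡⟨ [x+y]-x≡y a₁ a₄ ⟩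
      a₄             ∎
      where open ≡-Reasoning

module Critical {A B : List ℤ} (B! : Unique B) (S : Sorted₄ A) (B≢[] : B ≢ [])
                (critical : length (A +^ B) ≡ ℕ.suc (length B)) where
  open Sorted₄ S

  private
    no-excess : 2 ℕ.+ length B ℕ.≤ length (A +^ B) → ⊥
    no-excess excess = ℕ.1+n≰n (subst (2 ℕ.+ length B ℕ.≤_) critical excess)

    excess-∉ : ∀ {x k} → x ∉ B → 2 ℕ.≤ k → 2 ℕ.+ length B ℕ.≤ k ℕ.+ length (B ∖ x)
    excess-∉ x∉B 2≤k =
      subst (λ n → 2 ℕ.+ length B ℕ.≤ _ ℕ.+ n) (sym (length-∖-∉ x∉B)) (ℕ.+-monoˡ-≤ (length B) 2≤k)

    excess : ∀ {x k} → 3 ℕ.≤ k → 2 ℕ.+ length B ℕ.≤ k ℕ.+ length (B ∖ x)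
    excess 3≤k = ℕ.≤-trans (ℕ.+-monoʳ-≤ 2 (length-≤-suc-∖ B!)) (ℕ.+-monoˡ-≤ _ 3≤k)

  α : ℤ
  α = proj₁ (least B B≢[])
  α∈B : α ∈ B
  α∈B = proj₁ (proj₂ (least B B≢[]))
  α-least : ∀ {b} → b ∈ B → α ≤ b
  α-least = proj₂ (proj₂ (least B B≢[]))

  β : ℤ
  β = proj₁ (greatest B B≢[])
  β∈B : β ∈ B
  β∈B = proj₁ (proj₂ (greatest B B≢[]))
  β-greatest : ∀ {b} → b ∈ B → b ≤ β
  β-greatest = proj₂ (proj₂ (greatest B B≢[]))

  private
    no-excess-below : ∀ {Y} → Unique Y → (∀ {y} → y ∈ Y → y < a₄ × α + y ∈ A +^ B) →
                      2 ℕ.+ length B ℕ.≤ length Y ℕ.+ length (B ∖ a₄) → ⊥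
    no-excess-below Y! Y-below ex = no-excess (ℕ.≤-trans ex (length-+^-≥-below a₄∈A α-least B! Y! Y-below))

    no-excess-above : ∀ {Y} → Unique Y → (∀ {y} → y ∈ Y → a₁ < y × β + y ∈ A +^ B) →
                      2 ℕ.+ length B ℕ.≤ length Y ℕ.+ length (B ∖ a₁) → ⊥
    no-excess-above Y! Y-above ex = no-excess (ℕ.≤-trans ex (length-+^-≥-above a₁∈A β-greatest B! Y! Y-above))

    lower : List ℤ
    lower = (a₁ ∷ a₂ ∷ a₃ ∷ []) ∖ α
    upper : List ℤ
    upper = (a₂ ∷ a₃ ∷ a₄ ∷ []) ∖ β

    a₁a₂a₃! : Unique (a₁ ∷ a₂ ∷ a₃ ∷ [])
    a₁a₂a₃! = strictly-increasing⇒unique (a₁<a₂ ∷ a₂<a₃ ∷ [-])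

    a₂a₃a₄! : Unique (a₂ ∷ a₃ ∷ a₄ ∷ [])
    a₂a₃a₄! = strictly-increasing⇒unique (a₂<a₃ ∷ a₃<a₄ ∷ [-])

    lower! : Unique lower
    lower! = ∖-unique {α} a₁a₂a₃!

    upper! : Unique upper
    upper! = ∖-unique {β} a₂a₃a₄!

    lower⊆A : lower ⊆ A
    lower⊆A = proj₁ ∘ ∈-lower-three ∘ proj₁ ∘ ∈-∖⁻ {α} (a₁ ∷ a₂ ∷ a₃ ∷ [])

    lower-below : ∀ {y} → y ∈ lower → y < a₄ × α + y ∈ A +^ B
    lower-below y∈ with ∈-∖⁻ (a₁ ∷ a₂ ∷ a₃ ∷ []) y∈
    ... | y∈three , α≢y with ∈-lower-three y∈three
    ... | y∈A , y<a₄ = y<a₄ , subst (_∈ A +^ B) (ℤ.+-comm _ α) (∈-+^⁺ y∈A α∈B (α≢y ∘ sym))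

    upper-above : ∀ {y} → y ∈ upper → a₁ < y × β + y ∈ A +^ B
    upper-above y∈ with ∈-∖⁻ (a₂ ∷ a₃ ∷ a₄ ∷ []) y∈
    ... | y∈three , β≢y with ∈-upper-three y∈three
    ... | y∈A , a₁<y = a₁<y , subst (_∈ A +^ B) (ℤ.+-comm _ β) (∈-+^⁺ y∈A β∈B (β≢y ∘ sym))

    2≤|lower| : 2 ℕ.≤ length lower
    2≤|lower| = ℕ.≤-pred (length-≤-suc-∖ {α} a₁a₂a₃!)

    2≤|upper| : 2 ℕ.≤ length upper
    2≤|upper| = ℕ.≤-pred (length-≤-suc-∖ {β} a₂a₃a₄!)

  a₄∈B : a₄ ∈ B
  a₄∈B with a₄ ∈? B
  ... | yes a₄∈B = a₄∈B
  ... | no  a₄∉B = ⊥-elim (no-excess-below lower! lower-below (excess-∉ a₄∉B 2≤|lower|))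

  a₁∈B : a₁ ∈ B
  a₁∈B with a₁ ∈? B
  ... | yes a₁∈B = a₁∈B
  ... | no  a₁∉B = ⊥-elim (no-excess-above upper! upper-above (excess-∉ a₁∉B 2≤|upper|))

  α∈A : α ∈ A
  α∈A with α ∈? A
  ... | yes α∈A = α∈A
  ... | no  α∉A = ⊥-elim (no-excess-below lower! lower-below
                    (excess (ℕ.≤-reflexive (sym (length-∖-∉ (α∉A ∘ proj₁ ∘ ∈-lower-three))))))

  β∈A : β ∈ A
  β∈A with β ∈? A
  ... | yes β∈A = β∈A
  ... | no  β∉A = ⊥-elim (no-excess-above upper! upper-above
                    (excess (ℕ.≤-reflexive (sym (length-∖-∉ (β∉A ∘ proj₁ ∘ ∈-upper-three))))))

  B⊆A : B ⊆ A
  B⊆A {b} b∈B with b ∈? A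
  ... | yes b∈A = b∈A
  ... | no  b∉A = ⊥-elim (no-excess-below b∷lower! b∷lower-below (excess (ℕ.s≤s 2≤|lower|)))
    where
    b∷lower! : Unique (b ∷ lower)
    b∷lower! = All.tabulate (λ y∈ b≡y → b∉A (subst (_∈ A) (sym b≡y) (lower⊆A y∈))) ∷ lower!
    b∷lower-below : ∀ {y} → y ∈ b ∷ lower → y < a₄ × α + y ∈ A +^ B
    b∷lower-below (here refl) =
      ℤ.≤∧≢⇒< (ℤ.≤-trans (β-greatest b∈B) (a₄-greatest β∈A)) (λ { refl → b∉A a₄∈A }) ,
      ∈-+^⁺ α∈A b∈B (λ { refl → b∉A α∈A })
    b∷lower-below (there y∈) = lower-below y∈

  |B|≡4 : length B ≡ 4
  |B|≡4 = ℕ.≤-antisym (unique-⊆⇒length-≤ B! (⊆-enum ∘ B⊆A))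
                      (ℕ.≤-pred (subst (5 ℕ.≤_) critical (5≤length-+^ S a₁∈B a₄∈B)))

  A⊆B : A ⊆ B
  A⊆B {y} y∈A with y ∈? B
  ... | yes y∈B = y∈B
  ... | no  y∉B =
    ⊥-elim (ℕ.1+n≰n (subst (λ n → ℕ.suc n ℕ.≤ 4) |B|≡4 (unique-⊆⇒length-≤ y∷B! y∷B⊆enum)))
    where
    y∷B! : Unique (y ∷ B)
    y∷B! = All.tabulate (λ y'∈B y≡y' → y∉B (subst (_∈ B) (sym y≡y') y'∈B)) ∷ B!
    y∷B⊆enum : y ∷ B ⊆ a₁ ∷ a₂ ∷ a₃ ∷ a₄ ∷ []
    y∷B⊆enum (here refl) = ⊆-enum y∈A
    y∷B⊆enum (there z∈B) = ⊆-enum (B⊆A z∈B)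

  A≐B×parallelogram : (A ≐ B) × IsParallelogram A
  A≐B×parallelogram =
    (λ t → A⊆B , B⊆A) ,
    a₂+a₃≡a₁+a₄⇒parallelogram S
      (length-+^-≤5⇒a₂+a₃≡a₁+a₄ S A⊆B (ℕ.≤-reflexive (trans critical (cong ℕ.suc |B|≡4))))

module _ {a c d : ℤ} where
  private
    P T : List ℤ
    P = a ∷ c ∷ a + d ∷ c + d ∷ []
    T = a + c ∷ a + (a + d) ∷ a + (c + d) ∷ c + (c + d) ∷ (a + d) + (c + d) ∷ []

    x+[y+z]≡y+[x+z] : ∀ x y z → x + (y + z) ≡ y + (x + z)
    x+[y+z]≡y+[x+z] = solve-∀

    [x+z]+y≡x+[y+z] : ∀ x y z → (x + z) + y ≡ x + (y + z)
    [x+z]+y≡x+[y+z] = solve-∀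

  parallelogram-pair-sum : ∀ {u v} → u ∈ P → v ∈ P → u ≢ v → u + v ∈ T
  parallelogram-pair-sum first  first  u≢v = ⊥-elim (u≢v refl)
  parallelogram-pair-sum first  second _   = here refl
  parallelogram-pair-sum first  third  _   = there (here refl)
  parallelogram-pair-sum first  fourth _   = there (there (here refl))
  parallelogram-pair-sum second first  _   = here (ℤ.+-comm c a)
  parallelogram-pair-sum second second u≢v = ⊥-elim (u≢v refl)
  parallelogram-pair-sum second third  _   = there (there (here (x+[y+z]≡y+[x+z] c a d)))
  parallelogram-pair-sum second fourth _   = there (there (there (here refl)))
  parallelogram-pair-sum third  first  _   = there (here (ℤ.+-comm (a + d) a))
  parallelogram-pair-sum third  second _   = there (there (here ([x+z]+y≡x+[y+z] a c d)))
  parallelogram-pair-sum third  third  u≢v = ⊥-elim (u≢v refl)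
  parallelogram-pair-sum third  fourth _   = there (there (there (there (here refl))))
  parallelogram-pair-sum fourth first  _   = there (there (here (ℤ.+-comm (c + d) a)))
  parallelogram-pair-sum fourth second _   = there (there (there (here (ℤ.+-comm (c + d) c))))
  parallelogram-pair-sum fourth third  _   = there (there (there (there (here (ℤ.+-comm (c + d) (a + d))))))
  parallelogram-pair-sum fourth fourth u≢v = ⊥-elim (u≢v refl)

  length-+^-parallelogram-≤5 : ∀ {A B} → A ≐ P → B ⊆ A → length (A +^ B) ℕ.≤ 5
  length-+^-parallelogram-≤5 {A} {B} A≐P B⊆A = unique-⊆⇒length-≤ (+^-unique A B) A+^B⊆T
    where
    A+^B⊆T : A +^ B ⊆ T
    A+^B⊆T s∈ with ∈-+^⁻ s∈
    ... | u , v , u∈A , v∈B , u≢v , refl =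
      parallelogram-pair-sum (proj₁ (A≐P u) u∈A) (proj₁ (A≐P v) (B⊆A v∈B)) u≢v

≐⇒length-≡ : ∀ {A B} → Unique A → Unique B → A ≐ B → length A ≡ length B
≐⇒length-≡ A! B! A≐B =
  ℕ.≤-antisym (unique-⊆⇒length-≤ A! (λ {t} → proj₁ (A≐B t)))
              (unique-⊆⇒length-≤ B! (λ {t} → proj₂ (A≐B t)))

length-+^-≡5 : ∀ {A B} → Sorted₄ A → A ≐ B → IsParallelogram A → length (A +^ B) ≡ 5
length-+^-≡5 {A} {B} S A≐B (_ , _ , _ , A≐P) =
  ℕ.≤-antisym (length-+^-parallelogram-≤5 A≐P (λ {t} → proj₂ (A≐B t)))
              (5≤length-+^ S (A⊆B a₁∈A) (A⊆B a₄∈A))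
  where
  open Sorted₄ S
  A⊆B : A ⊆ B
  A⊆B {t} = proj₁ (A≐B t)

theorem3 : (A B : List ℤ) → Unique A → Unique B →
           length A ≡ 4 → length B ≥ 2 →
           (Data.Nat._+_ (length (A +^ B)) 3 ≡ Data.Nat._+_ (length A) (length B))
           ⇔ ((A ≐ B) × (∃[ a ] ∃[ c ] ∃[ d ] (A ≐ (a ∷ c ∷ (a + d) ∷ (c + d) ∷ []))))
theorem3 A B A! B! |A|≡4 |B|≥2 = mk⇔ forward backward
  where
  open ≡-Reasoning
  S : Sorted₄ A
  S = sort₄ A! |A|≡4

  forward : length (A +^ B) ℕ.+ 3 ≡ length A ℕ.+ length B → (A ≐ B) × IsParallelogram A
  forward |A+^B|+3≡|A|+|B| = Critical.A≐B×parallelogram B! S B≢[] (ℕ.+-cancelʳ-≡ 3 _ _ (begin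
    length (A +^ B) ℕ.+ 3  ≡⟨ |A+^B|+3≡|A|+|B| ⟩
    length A ℕ.+ length B  ≡⟨ cong (ℕ._+ length B) |A|≡4 ⟩
    3 ℕ.+ ℕ.suc (length B) ≡⟨ ℕ.+-comm 3 _ ⟩
    ℕ.suc (length B) ℕ.+ 3 ∎))
    where
    B≢[] : B ≢ []
    B≢[] B≡[] with () ← subst (λ xs → 2 ℕ.≤ length xs) B≡[] |B|≥2

  backward : (A ≐ B) × IsParallelogram A → length (A +^ B) ℕ.+ 3 ≡ length A ℕ.+ length B
  backward (A≐B , A-parallelogram) = begin
    length (A +^ B) ℕ.+ 3  ≡⟨ cong (ℕ._+ 3) (length-+^-≡5 S A≐B A-parallelogram) ⟩
    4 ℕ.+ 4                ≡⟨ cong₂ ℕ._+_ |A|≡4 (trans (sym (≐⇒length-≡ A! B! A≐B)) |A|≡4) ⟨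
    length A ℕ.+ length B  ∎
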